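{- For $n\ge0$ and $0\le j,k\le n$, \[B(n,k,j)=\binom{n}{j}\sum_{i=0}^{k}(-1)^{k-i}\binom{n+1}{k-i}\,i^{j}(i+1)^{n-j},\] with the convention $0^0=1$.
   Context: $\mathcal{B}_n$ is the set of signed permutations of order $n$: bijections $\sigma$ of $\{ -n,\ldots,n\}$ with $\sigma(-i)=-\sigma(i)$, identified with $(0,\sigma_1,\ldots,\sigma_n)$. $\mathrm{des}(\sigma)$ is the number of $i\in\{1,\ldots,n\}$ with $\sigma_{i-1}>\sigma_i$ ($\sigma_0=0$), $\mathrm{neg}(\sigma)$ the number of $i\in\{1,\ldots,n\}$ with $\sigma_i<0$. $B(n,k,j)$ is the number of $\sigma\in\mathcal{B}_n$ with $\mathrm{des}(\sigma)=k$ and $\mathrm{neg}(\sigma)=j$. -}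

module Defs where

open import Data.Nat using (ℕ; zero; suc; _+_; _*_; _∸_; _^_; _<ᵇ_)
open import Data.Nat.Combinatorics using (_C_)
open import Data.Integer as ℤ using (ℤ; +_; -[1+_]; ∣_∣)
open import Data.Bool using (Bool; true; false; if_then_else_; _∧_; not)
open import Data.List using (List; []; _∷_; map; concatMap; filter; length; upTo; sum; foldr)
open import Data.List.Relation.Unary.Unique.Propositional using (Unique)
open import Data.List.Relation.Unary.Unique.Propositional.Properties using ()
open import Data.Nat.Properties using () renaming (_≟_ to _≟ℕ_)
open import Relation.Nullary.Decidable using (⌊_⌋)
open import Data.List.Relation.Unary.Unique.DecPropositional _≟ℕ_ using (unique?)

-- A signed permutation of order n is represented by its window
-- (σ_1, …, σ_n) : a list of n nonzero integers in {-n..n} whose absolute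
-- values are pairwise distinct (hence form {1..n}).  σ_0 = 0 by convention.

nonzeroValues : ℕ → List ℤ
nonzeroValues n = map (λ i → + suc i) (upTo n) Data.List.++ map (λ i → -[1+ i ]) (upTo n)

words : {A : Set} → List A → ℕ → List (List A)
words xs zero = [] ∷ []
words xs (suc m) = concatMap (λ w → map (λ x → x ∷ w) xs) (words xs m)

signedPerms : ℕ → List (List ℤ)
signedPerms n = filter (λ w → unique? (map ∣_∣ w)) (words (nonzeroValues n) n)

desFrom : ℤ → List ℤ → ℕ
desFrom prev [] = 0
desFrom prev (x ∷ xs) = (if ⌊ x ℤ.<? prev ⌋ then 1 else 0) + desFrom x xs

des : List ℤ → ℕ
des w = desFrom (+ 0) w

neg : List ℤ → ℕ
neg [] = 0
neg (x ∷ xs) = (if ⌊ x ℤ.<? + 0 ⌋ then 1 else 0) + neg xs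

B : ℕ → ℕ → ℕ → ℕ
B n k j = length (filter (λ w → (des w Data.Nat.≟ k) Relation.Nullary.Decidable.×-dec (neg w Data.Nat.≟ j)) (signedPerms n))

sumTo : ℕ → (ℕ → ℤ) → ℤ
sumTo zero f = f 0
sumTo (suc k) f = sumTo k f ℤ.+ f (suc k)

sgn : ℕ → ℤ
sgn zero = + 1
sgn (suc m) = ℤ.- sgn m

-- right-hand side; ℕ's _^_ has 0 ^ 0 = 1
rhs : ℕ → ℕ → ℕ → ℤ
rhs n k j = + (n C j) ℤ.* sumTo k (λ i → sgn (k ∸ i) ℤ.* + (((suc n) C (k ∸ i)) * (i ^ j) * ((suc i) ^ (n ∸ j))))

-- Both sides satisfy the same recurrence.  Counting windows of length m over ±{1..n} with distinct
-- absolute values gives C(n, m) copies of the signed permutations of order m, and splitting off the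
-- letters ±(n + 1) shows that these numbers obey the insertion recurrence `step`.  On the other side,
-- Σ_k rhs(m, k, j) tᵏ = C(m, j) (1 - t)ᵐ⁺¹ Σ_i iʲ (1 + i)ᵐ⁻ʲ tⁱ, and passing from m to m + 1 multiplies
-- the weight by 1 + i or by i, which act on coefficient sequences as the two halves of `step`.

module Submission where

open import Defs
open import Data.Nat using (ℕ; zero; suc; _≤_)
open import Data.Integer using (+_)
open import Relation.Binary.PropositionalEquality using (_≡_; refl)

atPred : {A : Set} → A → ℕ → (ℕ → A) → A
atPred z zero f = z
atPred z (suc k) f = f k

atPred-cong : {A : Set} {z : A} (k : ℕ) {f g : ℕ → A} → (∀ i → f i ≡ g i) → atPred z k f ≡ atPred z k g
atPred-cong zero f≗g = refl
atPred-cong (suc k) f≗g = f≗g k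

module BinomialTransform where

  open import Data.Nat as ℕ using (ℕ; zero; suc; _∸_; _≤_; z≤n)
  open import Data.Nat.Properties as ℕ using (+-∸-assoc; n∸n≡0; m≤n⇒m≤1+n; ≤-refl; m≤n⇒∃[o]m+o≡n; m≤m+n; m+n∸m≡n)
  open import Data.Nat.Combinatorics using (_C_; nCk+nC[k+1]≡[n+1]C[k+1]; nC1≡n)
  import Data.Nat.Tactic.RingSolver as ℕ-Solver
  open import Data.Integer using (ℤ; +_; -_; _+_; _-_; _*_)
  open import Data.Integer.Properties using (pos-*; pos-+; *-identityˡ; *-zeroʳ; +-identityˡ; +-identityʳ; *-zeroˡ)
  open import Data.Integer.Tactic.RingSolver using (solve-∀)
  open import Data.Product using (_,_)
  open import Relation.Binary.PropositionalEquality
  open ≡-Reasoning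

  sumTo-cong : ∀ k {f g : ℕ → ℤ} → (∀ i → i ≤ k → f i ≡ g i) → sumTo k f ≡ sumTo k g
  sumTo-cong zero f≗g = f≗g 0 z≤n
  sumTo-cong (suc k) f≗g = cong₂ _+_ (sumTo-cong k (λ i i≤k → f≗g i (m≤n⇒m≤1+n i≤k))) (f≗g (suc k) ≤-refl)

  sumTo-+ : ∀ k (f g : ℕ → ℤ) → sumTo k (λ i → f i + g i) ≡ sumTo k f + sumTo k g
  sumTo-+ zero f g = refl
  sumTo-+ (suc k) f g rewrite sumTo-+ k f g = interchange (sumTo k f) (sumTo k g) (f (suc k)) (g (suc k))
    where
    interchange : ∀ x y z w → (x + y) + (z + w) ≡ (x + z) + (y + w)
    interchange = solve-∀

  sumTo-- : ∀ k (f g : ℕ → ℤ) → sumTo k (λ i → f i - g i) ≡ sumTo k f - sumTo k g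
  sumTo-- zero f g = refl
  sumTo-- (suc k) f g rewrite sumTo-- k f g = interchange (sumTo k f) (sumTo k g) (f (suc k)) (g (suc k))
    where
    interchange : ∀ x y z w → (x - y) + (z - w) ≡ (x + z) - (y + w)
    interchange = solve-∀

  sumTo-* : ∀ k c (f : ℕ → ℤ) → sumTo k (λ i → c * f i) ≡ c * sumTo k f
  sumTo-* zero c f = refl
  sumTo-* (suc k) c f rewrite sumTo-* k c f = distrib c (sumTo k f) (f (suc k))
    where
    distrib : ∀ c x y → c * x + c * y ≡ c * (x + y)
    distrib = solve-∀

  sumTo-zero : ∀ k (f : ℕ → ℤ) → (∀ i → i ≤ k → f i ≡ + 0) → sumTo k f ≡ + 0
  sumTo-zero zero f f≗0 = f≗0 0 z≤n
  sumTo-zero (suc k) f f≗0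
    rewrite sumTo-zero k f (λ i i≤k → f≗0 i (m≤n⇒m≤1+n i≤k)) | f≗0 (suc k) ≤-refl = refl

  -- ∇ M h k is the coefficient of tᵏ in (1 - t)ᴹ · Σᵢ h i tⁱ.
  ∇-term : ℕ → (ℕ → ℤ) → ℕ → ℕ → ℤ
  ∇-term M h k i = sgn (k ∸ i) * (+ (M C (k ∸ i)) * h i)

  ∇ : ℕ → (ℕ → ℤ) → ℕ → ℤ
  ∇ M h k = sumTo k (∇-term M h k)

  ∇-cong : ∀ M k {f g : ℕ → ℤ} → (∀ i → f i ≡ g i) → ∇ M f k ≡ ∇ M g k
  ∇-cong M k f≗g = sumTo-cong k (λ i _ → cong (λ z → sgn (k ∸ i) * (+ (M C (k ∸ i)) * z)) (f≗g i))

  ∇-+ : ∀ M k (f g : ℕ → ℤ) → ∇ M (λ i → f i + g i) k ≡ ∇ M f k + ∇ M g k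
  ∇-+ M k f g = trans (sumTo-cong k (λ i _ → distrib (sgn (k ∸ i)) (+ (M C (k ∸ i))) (f i) (g i))) (sumTo-+ k _ _)
    where
    distrib : ∀ s c x y → s * (c * (x + y)) ≡ s * (c * x) + s * (c * y)
    distrib = solve-∀

  ∇-term-diagonal : ∀ M h k → ∇-term M h k k ≡ h k
  ∇-term-diagonal M h k rewrite n∸n≡0 k = trans (*-identityˡ _) (*-identityˡ (h k))

  ∇-term-suc : ∀ M h {k i} → i ≤ k → ∇-term (suc M) h (suc k) i ≡ ∇-term M h (suc k) i - ∇-term M h k i
  ∇-term-suc M h {k} {i} i≤k rewrite +-∸-assoc 1 i≤k = begin
      - sgn r * (+ (suc M C suc r) * h i)
    ≡⟨ cong (λ z → - sgn r * (+ z * h i)) (sym (nCk+nC[k+1]≡[n+1]C[k+1] M r)) ⟩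
      - sgn r * (+ (M C r ℕ.+ M C suc r) * h i)
    ≡⟨ cong (λ z → - sgn r * (z * h i)) (pos-+ (M C r) (M C suc r)) ⟩
      - sgn r * ((+ (M C r) + + (M C suc r)) * h i)
    ≡⟨ split (sgn r) (+ (M C r)) (+ (M C suc r)) (h i) ⟩
      - sgn r * (+ (M C suc r) * h i) - sgn r * (+ (M C r) * h i) ∎
    where
    r = k ∸ i
    split : ∀ s c c′ x → - s * ((c + c′) * x) ≡ - s * (c′ * x) - s * (c * x)
    split = solve-∀

  ∇-zero : ∀ h k → ∇ 0 h k ≡ h k
  ∇-zero h zero = ∇-term-diagonal 0 h 0
  ∇-zero h (suc k) = begin
      sumTo k (∇-term 0 h (suc k)) + ∇-term 0 h (suc k) (suc k)
    ≡⟨ cong₂ _+_ (sumTo-zero k _ off-diagonal) (∇-term-diagonal 0 h (suc k)) ⟩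
      + 0 + h (suc k)
    ≡⟨ +-identityˡ (h (suc k)) ⟩
      h (suc k) ∎
    where
    off-diagonal : ∀ i → i ≤ k → ∇-term 0 h (suc k) i ≡ + 0
    off-diagonal i i≤k rewrite +-∸-assoc 1 i≤k = *-zeroʳ (sgn (suc (k ∸ i)))

  ∇-suc : ∀ M h k → ∇ (suc M) h (suc k) ≡ ∇ M h (suc k) - ∇ M h k
  ∇-suc M h k = begin
      sumTo k (∇-term (suc M) h (suc k)) + ∇-term (suc M) h (suc k) (suc k)
    ≡⟨ cong₂ _+_ (sumTo-cong k (λ i → ∇-term-suc M h)) (trans (∇-term-diagonal (suc M) h (suc k)) (sym (∇-term-diagonal M h (suc k)))) ⟩
      sumTo k (λ i → ∇-term M h (suc k) i - ∇-term M h k i) + ∇-term M h (suc k) (suc k)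
    ≡⟨ cong (_+ ∇-term M h (suc k) (suc k)) (sumTo-- k _ _) ⟩
      (sumTo k (∇-term M h (suc k)) - ∇ M h k) + ∇-term M h (suc k) (suc k)
    ≡⟨ reorder (sumTo k (∇-term M h (suc k))) (∇ M h k) (∇-term M h (suc k) (suc k)) ⟩
      ∇ M h (suc k) - ∇ M h k ∎
    where
    reorder : ∀ x y z → (x - y) + z ≡ (x + z) - y
    reorder = solve-∀

  [1+r]*MC[1+r]+r*MCr≡M*MCr : ∀ M r → suc r ℕ.* (M C suc r) ℕ.+ r ℕ.* (M C r) ≡ M ℕ.* (M C r)
  [1+r]*MC[1+r]+r*MCr≡M*MCr zero zero = refl
  [1+r]*MC[1+r]+r*MCr≡M*MCr zero (suc r) = cong₂ ℕ._+_ (ℕ.*-zeroʳ (suc (suc r))) (ℕ.*-zeroʳ (suc r))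
  [1+r]*MC[1+r]+r*MCr≡M*MCr (suc M) zero =
    trans (ℕ.+-identityʳ _) (trans (ℕ.*-identityˡ _) (trans (nC1≡n (suc M)) (sym (ℕ.*-identityʳ (suc M)))))
  [1+r]*MC[1+r]+r*MCr≡M*MCr (suc M) (suc r)
    rewrite sym (nCk+nC[k+1]≡[n+1]C[k+1] M (suc r)) | sym (nCk+nC[k+1]≡[n+1]C[k+1] M r) = begin
      suc (suc r) ℕ.* (c₁ ℕ.+ c₂) ℕ.+ suc r ℕ.* (c₀ ℕ.+ c₁)
    ≡⟨ regroup r c₀ c₁ c₂ ⟩
      (suc (suc r) ℕ.* c₂ ℕ.+ suc r ℕ.* c₁) ℕ.+ c₁ ℕ.+ (suc r ℕ.* c₁ ℕ.+ r ℕ.* c₀) ℕ.+ c₀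
    ≡⟨ cong₂ (λ u v → u ℕ.+ c₁ ℕ.+ v ℕ.+ c₀) ([1+r]*MC[1+r]+r*MCr≡M*MCr M (suc r)) ([1+r]*MC[1+r]+r*MCr≡M*MCr M r) ⟩
      M ℕ.* c₁ ℕ.+ c₁ ℕ.+ M ℕ.* c₀ ℕ.+ c₀
    ≡⟨ collect M c₀ c₁ ⟩
      suc M ℕ.* (c₀ ℕ.+ c₁) ∎
    where
    c₀ = M C r
    c₁ = M C suc r
    c₂ = M C suc (suc r)
    regroup : ∀ r c₀ c₁ c₂ → suc (suc r) ℕ.* (c₁ ℕ.+ c₂) ℕ.+ suc r ℕ.* (c₀ ℕ.+ c₁)
            ≡ (suc (suc r) ℕ.* c₂ ℕ.+ suc r ℕ.* c₁) ℕ.+ c₁ ℕ.+ (suc r ℕ.* c₁ ℕ.+ r ℕ.* c₀) ℕ.+ c₀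
    regroup = ℕ-Solver.solve-∀
    collect : ∀ M c₀ c₁ → M ℕ.* c₁ ℕ.+ c₁ ℕ.+ M ℕ.* c₀ ℕ.+ c₀ ≡ suc M ℕ.* (c₀ ℕ.+ c₁)
    collect = ℕ-Solver.solve-∀

  [1+r]*MC[1+r]≡[M-r]*MCr : ∀ M r → + suc r * + (M C suc r) ≡ (+ M - + r) * + (M C r)
  [1+r]*MC[1+r]≡[M-r]*MCr M r = begin
      + suc r * c₁
    ≡⟨ add-sub (+ suc r * c₁) (+ r * c₀) ⟩
      (+ suc r * c₁ + + r * c₀) - + r * c₀
    ≡⟨ cong (_- + r * c₀) absorption ⟩
      + M * c₀ - + r * c₀
    ≡⟨ factor (+ M) (+ r) c₀ ⟩
      (+ M - + r) * c₀ ∎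
    where
    c₀ = + (M C r)
    c₁ = + (M C suc r)
    absorption : + suc r * c₁ + + r * c₀ ≡ + M * c₀
    absorption = begin
        + suc r * c₁ + + r * c₀
      ≡⟨ sym (cong₂ _+_ (pos-* (suc r) (M C suc r)) (pos-* r (M C r))) ⟩
        + (suc r ℕ.* (M C suc r)) + + (r ℕ.* (M C r))
      ≡⟨ sym (pos-+ (suc r ℕ.* (M C suc r)) (r ℕ.* (M C r))) ⟩
        + (suc r ℕ.* (M C suc r) ℕ.+ r ℕ.* (M C r))
      ≡⟨ cong +_ ([1+r]*MC[1+r]+r*MCr≡M*MCr M r) ⟩
        + (M ℕ.* (M C r))
      ≡⟨ pos-* M (M C r) ⟩
        + M * c₀ ∎
    add-sub : ∀ x y → x ≡ (x + y) - y
    add-sub = solve-∀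
    factor : ∀ x y z → x * z - y * z ≡ (x - y) * z
    factor = solve-∀

  ∇-term-weight : ∀ M h {k i} → i ≤ k →
    ∇-term M (λ i → + i * h i) (suc k) i - ∇-term M (λ i → + i * h i) k i
      ≡ + suc k * ∇-term M h (suc k) i + (+ M - + k) * ∇-term M h k i
  ∇-term-weight M h {i = i} i≤k with m≤n⇒∃[o]m+o≡n i≤k
  ... | r , refl rewrite +-∸-assoc 1 (m≤m+n i r) | m+n∸m≡n i r =
    weighted (sgn r) (h i) (+ (M C r)) (+ (M C suc r)) (+ i) (+ r) (+ M) ([1+r]*MC[1+r]≡[M-r]*MCr M r)
    where
    weighted : ∀ s x c c′ I R M → (+ 1 + R) * c′ ≡ (M - R) * c →
      - s * (c′ * (I * x)) - s * (c * (I * x))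
        ≡ (+ 1 + (I + R)) * (- s * (c′ * x)) + (M - (I + R)) * (s * (c * x))
    weighted s x c c′ I R M pascal = begin
        - s * (c′ * (I * x)) - s * (c * (I * x))
      ≡⟨ expand s x c c′ I R M ⟩
        rhs′ + s * x * ((+ 1 + R) * c′ - (M - R) * c)
      ≡⟨ cong (λ z → rhs′ + s * x * (z - (M - R) * c)) pascal ⟩
        rhs′ + s * x * ((M - R) * c - (M - R) * c)
      ≡⟨ cancel rhs′ (s * x) ((M - R) * c) ⟩
        rhs′ ∎
      where
      rhs′ = (+ 1 + (I + R)) * (- s * (c′ * x)) + (M - (I + R)) * (s * (c * x))
      expand : ∀ s x c c′ I R M → - s * (c′ * (I * x)) - s * (c * (I * x))
        ≡ ((+ 1 + (I + R)) * (- s * (c′ * x)) + (M - (I + R)) * (s * (c * x))) + s * x * ((+ 1 + R) * c′ - (M - R) * c)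
      expand = solve-∀
      cancel : ∀ y z w → y + z * (w - w) ≡ y
      cancel = solve-∀

  -- With G = (1 - t)ᴹ H this is (1 - t)ᴹ⁺¹ t H′ = t (1 - t) G′ + M t G.
  ∇-mul-i : ∀ M h k →
    ∇ (suc M) (λ i → + i * h i) k ≡ + k * ∇ M h k + atPred (+ 0) k (λ k′ → (+ M - + k′) * ∇ M h k′)
  ∇-mul-i M h zero = sym (trans (+-identityʳ _) (*-zeroˡ (∇ M h 0)))
  ∇-mul-i M h (suc k) = begin
      ∇ (suc M) ih (suc k)
    ≡⟨ ∇-suc M ih k ⟩
      (sumTo k (U (suc k)) + U (suc k) (suc k)) - ∇ M ih k
    ≡⟨ reorder (sumTo k (U (suc k))) (U (suc k) (suc k)) (∇ M ih k) ⟩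
      (sumTo k (U (suc k)) - sumTo k (U k)) + U (suc k) (suc k)
    ≡⟨ cong₂ _+_ (sym (sumTo-- k (U (suc k)) (U k))) diagonal ⟩
      sumTo k (λ i → U (suc k) i - U k i) + c * T (suc k) (suc k)
    ≡⟨ cong (_+ c * T (suc k) (suc k)) (trans (sumTo-cong k (λ i → ∇-term-weight M h)) (sumTo-+ k _ _)) ⟩
      (sumTo k (λ i → c * T (suc k) i) + sumTo k (λ i → d * T k i)) + c * T (suc k) (suc k)
    ≡⟨ cong (λ z → z + c * T (suc k) (suc k)) (cong₂ _+_ (sumTo-* k c (T (suc k))) (sumTo-* k d (T k))) ⟩
      (c * sumTo k (T (suc k)) + d * ∇ M h k) + c * T (suc k) (suc k)
    ≡⟨ regroup c d (sumTo k (T (suc k))) (∇ M h k) (T (suc k) (suc k)) ⟩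
      c * ∇ M h (suc k) + d * ∇ M h k ∎
    where
    ih : ℕ → ℤ
    ih i = + i * h i
    c = + suc k
    d = + M - + k
    T U : ℕ → ℕ → ℤ
    T = ∇-term M h
    U = ∇-term M ih
    diagonal : U (suc k) (suc k) ≡ c * T (suc k) (suc k)
    diagonal = trans (∇-term-diagonal M ih (suc k)) (cong (c *_) (sym (∇-term-diagonal M h (suc k))))
    reorder : ∀ x y z → (x + y) - z ≡ (x - z) + y
    reorder = solve-∀
    regroup : ∀ c d x y z → (c * x + d * y) + c * z ≡ c * (x + z) + d * y
    regroup = solve-∀

  ∇-mul-1+i : ∀ M h k →
    ∇ (suc (suc M)) (λ i → + suc i * h i) k ≡ + suc k * ∇ (suc M) h k + atPred (+ 0) k (λ k′ → (+ M - + k′) * ∇ (suc M) h k′)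
  ∇-mul-1+i M h zero = begin
      ∇-term (suc (suc M)) (λ i → + suc i * h i) 0 0
    ≡⟨ ∇-term-diagonal (suc (suc M)) (λ i → + suc i * h i) 0 ⟩
      + 1 * h 0
    ≡⟨ cong (+ 1 *_) (sym (∇-term-diagonal (suc M) h 0)) ⟩
      + 1 * ∇ (suc M) h 0
    ≡⟨ sym (+-identityʳ _) ⟩
      + 1 * ∇ (suc M) h 0 + + 0 ∎
  ∇-mul-1+i M h (suc k) = begin
      ∇ (suc (suc M)) (λ i → + suc i * h i) (suc k)
    ≡⟨ ∇-cong (suc (suc M)) (suc k) (λ i → split (+ i) (h i)) ⟩
      ∇ (suc (suc M)) (λ i → + i * h i + h i) (suc k)
    ≡⟨ ∇-+ (suc (suc M)) (suc k) _ h ⟩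
      ∇ (suc (suc M)) (λ i → + i * h i) (suc k) + ∇ (suc (suc M)) h (suc k)
    ≡⟨ cong₂ _+_ (∇-mul-i (suc M) h (suc k)) (∇-suc (suc M) h k) ⟩
      (+ suc k * ∇ (suc M) h (suc k) + (+ suc M - + k) * ∇ (suc M) h k) + (∇ (suc M) h (suc k) - ∇ (suc M) h k)
    ≡⟨ collect (+ k) (+ M) (∇ (suc M) h (suc k)) (∇ (suc M) h k) ⟩
      + suc (suc k) * ∇ (suc M) h (suc k) + (+ M - + k) * ∇ (suc M) h k ∎
    where
    split : ∀ x y → (+ 1 + x) * y ≡ x * y + y
    split = solve-∀
    collect : ∀ k M x y → ((+ 1 + k) * x + ((+ 1 + M) - k) * y) + (x - y) ≡ (+ 1 + (+ 1 + k)) * x + (M - k) * y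
    collect = solve-∀

module RightHandSide where

  open BinomialTransform
  open import Data.Nat as ℕ using (ℕ; zero; suc; _∸_; _^_; _≤_; _<_; _≤?_)
  open import Data.Nat.Properties as ℕ using (+-∸-assoc; ≰⇒>)
  open import Data.Nat.Combinatorics using (_C_; nCk+nC[k+1]≡[n+1]C[k+1])
  open import Data.Nat.Combinatorics.Specification using (k>n⇒nCk≡0)
  import Data.Nat.Tactic.RingSolver as ℕ-Solver
  open import Data.Integer using (ℤ; +_; -_; _+_; _-_; _*_)
  open import Data.Integer.Properties using (pos-*; pos-+; *-zeroʳ; +-identityʳ; *-distribˡ-+; *-distribʳ-+)
  open import Data.Integer.Tactic.RingSolver using (solve-∀)
  open import Relation.Nullary using (yes; no)
  open import Relation.Binary.PropositionalEquality
  open ≡-Reasoning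

  atPred-* : ∀ k c (f : ℕ → ℤ) → c * atPred (+ 0) k f ≡ atPred (+ 0) k (λ i → c * f i)
  atPred-* zero c f = *-zeroʳ c
  atPred-* (suc k) c f = refl

  weight : ℕ → ℕ → ℕ → ℤ
  weight m j i = + (i ^ j ℕ.* suc i ^ (m ∸ j))

  rhs≡C*∇ : ∀ m k j → rhs m k j ≡ + (m C j) * ∇ (suc m) (weight m j) k
  rhs≡C*∇ m k j = cong (+ (m C j) *_) (sumTo-cong k (λ i _ → cong (sgn (k ∸ i) *_)
    (trans (cong +_ (ℕ.*-assoc (suc m C (k ∸ i)) (i ^ j) (suc i ^ (m ∸ j)))) (pos-* (suc m C (k ∸ i)) _))))

  weight-suc : ∀ m j i → j ≤ m → weight (suc m) j i ≡ + suc i * weight m j i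
  weight-suc m j i j≤m rewrite +-∸-assoc 1 j≤m =
    trans (cong +_ (swap (i ^ j) (suc i) (suc i ^ (m ∸ j)))) (pos-* (suc i) _)
    where
    swap : ∀ x y z → x ℕ.* (y ℕ.* z) ≡ y ℕ.* (x ℕ.* z)
    swap = ℕ-Solver.solve-∀

  weight-suc-suc : ∀ m j i → weight (suc m) (suc j) i ≡ + i * weight m j i
  weight-suc-suc m j i = trans (cong +_ (ℕ.*-assoc i (i ^ j) (suc i ^ (m ∸ j)))) (pos-* i _)

  rhs-vanishes : ∀ {m} k {j} → m < j → rhs m k j ≡ + 0
  rhs-vanishes {m} k {j} m<j = trans (rhs≡C*∇ m k j) (cong (_* ∇ (suc m) (weight m j) k) (cong +_ (k>n⇒nCk≡0 m<j)))

  stepℤ⁺ stepℤ⁻ stepℤ : ℕ → (ℕ → ℕ → ℤ) → ℕ → ℕ → ℤ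
  stepℤ⁺ m R k j = + suc k * R k j + atPred (+ 0) k (λ k′ → (+ m - + k′) * R k′ j)
  stepℤ⁻ m R k j = + k * R k j + atPred (+ 0) k (λ k′ → (+ suc m - + k′) * R k′ j)
  stepℤ m R k j = stepℤ⁺ m R k j + atPred (+ 0) j (stepℤ⁻ m R k)

  stepℤ⁺-cong : ∀ m k j {R R′ : ℕ → ℕ → ℤ} → (∀ k′ → R k′ j ≡ R′ k′ j) → stepℤ⁺ m R k j ≡ stepℤ⁺ m R′ k j
  stepℤ⁺-cong m k j R≗R′ = cong₂ _+_ (cong (+ suc k *_) (R≗R′ k)) (atPred-cong k (λ k′ → cong ((+ m - + k′) *_) (R≗R′ k′)))

  stepℤ⁻-cong : ∀ m k j {R R′ : ℕ → ℕ → ℤ} → (∀ k′ → R k′ j ≡ R′ k′ j) → stepℤ⁻ m R k j ≡ stepℤ⁻ m R′ k j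
  stepℤ⁻-cong m k j R≗R′ = cong₂ _+_ (cong (+ k *_) (R≗R′ k)) (atPred-cong k (λ k′ → cong ((+ suc m - + k′) *_) (R≗R′ k′)))

  stepℤ-cong : ∀ m k j {R R′ : ℕ → ℕ → ℤ} → (∀ k′ j′ → R k′ j′ ≡ R′ k′ j′) → stepℤ m R k j ≡ stepℤ m R′ k j
  stepℤ-cong m k j {R} {R′} R≗R′ = cong₂ _+_ (stepℤ⁺-cong m k j {R} {R′} (λ k′ → R≗R′ k′ j))
    (atPred-cong j (λ j′ → stepℤ⁻-cong m k j′ {R} {R′} (λ k′ → R≗R′ k′ j′)))

  rhs-step⁺ : ∀ m j k → + (m C j) * ∇ (suc (suc m)) (weight (suc m) j) k ≡ stepℤ⁺ m (rhs m) k j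
  rhs-step⁺ m j k with j ≤? m
  ... | yes j≤m = begin
      c * ∇ (suc (suc m)) (weight (suc m) j) k
    ≡⟨ cong (c *_) (trans (∇-cong (suc (suc m)) k (λ i → weight-suc m j i j≤m)) (∇-mul-1+i m (weight m j) k)) ⟩
      c * (+ suc k * ∇′ k + atPred (+ 0) k (λ k′ → (+ m - + k′) * ∇′ k′))
    ≡⟨ *-distribˡ-+ c _ _ ⟩
      c * (+ suc k * ∇′ k) + c * atPred (+ 0) k (λ k′ → (+ m - + k′) * ∇′ k′)
    ≡⟨ cong₂ _+_ (pull c (+ suc k) (∇′ k)) (trans (atPred-* k c _) (atPred-cong k (λ k′ → pull c (+ m - + k′) (∇′ k′)))) ⟩
      + suc k * (c * ∇′ k) + atPred (+ 0) k (λ k′ → (+ m - + k′) * (c * ∇′ k′))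
    ≡⟨ stepℤ⁺-cong m k j {λ k′ _ → c * ∇′ k′} {rhs m} (λ k′ → sym (rhs≡C*∇ m k′ j)) ⟩
      stepℤ⁺ m (rhs m) k j ∎
    where
    c = + (m C j)
    ∇′ = ∇ (suc m) (weight m j)
    pull : ∀ x y z → x * (y * z) ≡ y * (x * z)
    pull = solve-∀
  ... | no j≰m = begin
      + (m C j) * ∇ (suc (suc m)) (weight (suc m) j) k
    ≡⟨ cong (λ z → + z * ∇ (suc (suc m)) (weight (suc m) j) k) (k>n⇒nCk≡0 m<j) ⟩
      + 0
    ≡⟨ sym (stepℤ⁺-zero k) ⟩
      stepℤ⁺ m (λ _ _ → + 0) k j
    ≡⟨ stepℤ⁺-cong m k j {λ _ _ → + 0} {rhs m} (λ k′ → sym (rhs-vanishes k′ m<j)) ⟩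
      stepℤ⁺ m (rhs m) k j ∎
    where
    m<j = ≰⇒> j≰m
    stepℤ⁺-zero : ∀ k → stepℤ⁺ m (λ _ _ → + 0) k j ≡ + 0
    stepℤ⁺-zero zero = refl
    stepℤ⁺-zero (suc k) = cong₂ _+_ (*-zeroʳ (+ suc (suc k))) (*-zeroʳ (+ m - + k))

  rhs-step⁻ : ∀ m j k → + (m C j) * ∇ (suc (suc m)) (weight (suc m) (suc j)) k ≡ stepℤ⁻ m (rhs m) k j
  rhs-step⁻ m j k = begin
      c * ∇ (suc (suc m)) (weight (suc m) (suc j)) k
    ≡⟨ cong (c *_) (trans (∇-cong (suc (suc m)) k (weight-suc-suc m j)) (∇-mul-i (suc m) (weight m j) k)) ⟩
      c * (+ k * ∇′ k + atPred (+ 0) k (λ k′ → (+ suc m - + k′) * ∇′ k′))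
    ≡⟨ *-distribˡ-+ c _ _ ⟩
      c * (+ k * ∇′ k) + c * atPred (+ 0) k (λ k′ → (+ suc m - + k′) * ∇′ k′)
    ≡⟨ cong₂ _+_ (pull c (+ k) (∇′ k)) (trans (atPred-* k c _) (atPred-cong k (λ k′ → pull c (+ suc m - + k′) (∇′ k′)))) ⟩
      + k * (c * ∇′ k) + atPred (+ 0) k (λ k′ → (+ suc m - + k′) * (c * ∇′ k′))
    ≡⟨ stepℤ⁻-cong m k j {λ k′ _ → c * ∇′ k′} {rhs m} (λ k′ → sym (rhs≡C*∇ m k′ j)) ⟩
      stepℤ⁻ m (rhs m) k j ∎
    where
    c = + (m C j)
    ∇′ = ∇ (suc m) (weight m j)
    pull : ∀ x y z → x * (y * z) ≡ y * (x * z)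
    pull = solve-∀

  -- Pascal's rule splits C(m + 1, j) into C(m, j) and C(m, j - 1), and passing from m to
  -- m + 1 multiplies the weight by 1 + i in the first part and by i in the second.
  rhs-step : ∀ m k j → rhs (suc m) k j ≡ stepℤ m (rhs m) k j
  rhs-step m k zero = trans (rhs≡C*∇ (suc m) k 0) (trans (rhs-step⁺ m 0 k) (sym (+-identityʳ _)))
  rhs-step m k (suc j) = begin
      rhs (suc m) k (suc j)
    ≡⟨ rhs≡C*∇ (suc m) k (suc j) ⟩
      + (suc m C suc j) * A
    ≡⟨ cong (λ z → + z * A) (sym (trans (ℕ.+-comm (m C suc j) (m C j)) (nCk+nC[k+1]≡[n+1]C[k+1] m j))) ⟩
      + (m C suc j ℕ.+ m C j) * A
    ≡⟨ trans (cong (_* A) (pos-+ (m C suc j) (m C j))) (*-distribʳ-+ A (+ (m C suc j)) (+ (m C j))) ⟩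
      + (m C suc j) * A + + (m C j) * A
    ≡⟨ cong₂ _+_ (rhs-step⁺ m (suc j) k) (rhs-step⁻ m j k) ⟩
      stepℤ m (rhs m) k (suc j) ∎
    where
    A = ∇ (suc (suc m)) (weight (suc m) (suc j)) k

module InsertionRecurrence where

  open BinomialTransform
  open RightHandSide
  open import Data.Nat using (ℕ; zero; suc; _+_; _*_; _∸_; _≤_; _<_; _≤?_; s≤s)
  open import Data.Nat.Properties using (≰⇒>; m<n⇒m<1+n; *-zeroʳ; ≤-<-trans; ≤-refl; n≤1+n)
  open import Data.Sum using (_⊎_; inj₁; inj₂)
  import Data.Nat.Tactic.RingSolver as ℕ-Solver
  open import Data.Integer as ℤ using (ℤ; +_)
  open import Data.Integer.Properties as ℤ using (pos-*; pos-+; m-n≡m⊖n; ⊖-≥)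
  open import Relation.Nullary using (yes; no)
  open import Relation.Binary.PropositionalEquality
  open ≡-Reasoning

  -- Inserting a letter larger than all others into a word of length m with d descents creates no
  -- new descent in d + 1 positions and one in the other m - d; inserting a letter smaller than all
  -- others creates none in d positions and one in the other m + 1 - d.
  step⁺ step⁻ step : ℕ → (ℕ → ℕ → ℕ) → ℕ → ℕ → ℕ
  step⁺ m G k j = suc k * G k j + atPred 0 k (λ k′ → (m ∸ k′) * G k′ j)
  step⁻ m G k j = k * G k j + atPred 0 k (λ k′ → (suc m ∸ k′) * G k′ j)
  step m G k j = step⁺ m G k j + atPred 0 j (step⁻ m G k)

  signedEulerian : ℕ → ℕ → ℕ → ℕ
  signedEulerian zero zero zero = 1
  signedEulerian zero zero (suc j) = 0
  signedEulerian zero (suc k) j = 0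
  signedEulerian (suc m) k j = step m (signedEulerian m) k j

  signedEulerian-vanishes : ∀ {m k} j → m < k → signedEulerian m k j ≡ 0
  signedEulerian-vanishes {zero} {suc k} j _ = refl
  signedEulerian-vanishes {suc m} {suc k} j (s≤s m<k) = cong₂ _+_ step⁺-vanishes (step⁻-vanishes j)
    where
    vanish : ∀ c {k′} j → m < k′ → c * signedEulerian m k′ j ≡ 0
    vanish c j m<k′ = trans (cong (c *_) (signedEulerian-vanishes j m<k′)) (*-zeroʳ c)
    step⁺-vanishes : step⁺ m (signedEulerian m) (suc k) j ≡ 0
    step⁺-vanishes = cong₂ _+_ (vanish (suc (suc k)) j (m<n⇒m<1+n m<k)) (vanish (m ∸ k) j m<k)
    step⁻-vanishes : ∀ j → atPred 0 j (step⁻ m (signedEulerian m) (suc k)) ≡ 0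
    step⁻-vanishes zero = refl
    step⁻-vanishes (suc j) = cong₂ _+_ (vanish (suc k) j (m<n⇒m<1+n m<k)) (vanish (suc m ∸ k) j m<k)

  pos-atPred : ∀ k (f : ℕ → ℕ) → + atPred 0 k f ≡ atPred (+ 0) k (λ i → + f i)
  pos-atPred zero f = refl
  pos-atPred (suc k) f = refl

  pos-[M∸k]*x : ∀ M k x → k ≤ M ⊎ x ≡ 0 → + ((M ∸ k) * x) ≡ (+ M ℤ.- + k) ℤ.* + x
  pos-[M∸k]*x M k x (inj₁ k≤M) = trans (pos-* (M ∸ k) x) (cong (ℤ._* + x) (sym (trans (m-n≡m⊖n M k) (⊖-≥ k≤M))))
  pos-[M∸k]*x M k .0 (inj₂ refl) = trans (cong +_ (*-zeroʳ (M ∸ k))) (sym (ℤ.*-zeroʳ (+ M ℤ.- + k)))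

  pos-step : ∀ m k j (G : ℕ → ℕ → ℕ) → (∀ {k′} j′ → m < k′ → G k′ j′ ≡ 0) →
    + step m G k j ≡ stepℤ m (λ k′ j′ → + G k′ j′) k j
  pos-step m k j G G-vanishes = begin
      + (step⁺ m G k j + atPred 0 j (step⁻ m G k))
    ≡⟨ pos-+ (step⁺ m G k j) _ ⟩
      + step⁺ m G k j ℤ.+ + atPred 0 j (step⁻ m G k)
    ≡⟨ cong₂ ℤ._+_ (pos-step⁺ j) (trans (pos-atPred j (step⁻ m G k)) (atPred-cong j pos-step⁻)) ⟩
      stepℤ m (λ k′ j′ → + G k′ j′) k j ∎
    where
    in-range-or-vanishes : ∀ {M} k′ j′ → m ≤ M → k′ ≤ M ⊎ G k′ j′ ≡ 0
    in-range-or-vanishes {M} k′ j′ m≤M with k′ ≤? M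
    ... | yes k′≤M = inj₁ k′≤M
    ... | no k′≰M = inj₂ (G-vanishes j′ (≤-<-trans m≤M (≰⇒> k′≰M)))
    pos-step⁺ : ∀ j′ → + step⁺ m G k j′ ≡ stepℤ⁺ m (λ k′ j′ → + G k′ j′) k j′
    pos-step⁺ j′ = trans (pos-+ (suc k * G k j′) _) (cong₂ ℤ._+_ (pos-* (suc k) (G k j′))
      (trans (pos-atPred k _) (atPred-cong k (λ k′ → pos-[M∸k]*x m k′ (G k′ j′) (in-range-or-vanishes k′ j′ ≤-refl)))))
    pos-step⁻ : ∀ j′ → + step⁻ m G k j′ ≡ stepℤ⁻ m (λ k′ j′ → + G k′ j′) k j′
    pos-step⁻ j′ = trans (pos-+ (k * G k j′) _) (cong₂ ℤ._+_ (pos-* k (G k j′))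
      (trans (pos-atPred k _) (atPred-cong k (λ k′ → pos-[M∸k]*x (suc m) k′ (G k′ j′) (in-range-or-vanishes k′ j′ (n≤1+n m))))))

  step-cong : ∀ m k j {G G′ : ℕ → ℕ → ℕ} → (∀ k′ j′ → G k′ j′ ≡ G′ k′ j′) → step m G k j ≡ step m G′ k j
  step-cong m k j G≗G′ = cong₂ _+_
    (cong₂ _+_ (cong (suc k *_) (G≗G′ k j)) (atPred-cong k (λ k′ → cong ((m ∸ k′) *_) (G≗G′ k′ j))))
    (atPred-cong j (λ j′ → cong₂ _+_ (cong (k *_) (G≗G′ k j′)) (atPred-cong k (λ k′ → cong ((suc m ∸ k′) *_) (G≗G′ k′ j′)))))

  step-* : ∀ m k j c (G : ℕ → ℕ → ℕ) → step m (λ k′ j′ → c * G k′ j′) k j ≡ c * step m G k j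
  step-* m zero zero c G = ring c (G 0 0)
    where
    ring : ∀ c x → (1 * (c * x) + 0) + 0 ≡ c * ((1 * x + 0) + 0)
    ring = ℕ-Solver.solve-∀
  step-* m zero (suc j) c G = ring c (G 0 (suc j)) (G 0 j)
    where
    ring : ∀ c x y → (1 * (c * x) + 0) + (0 * (c * y) + 0) ≡ c * ((1 * x + 0) + (0 * y + 0))
    ring = ℕ-Solver.solve-∀
  step-* m (suc k) zero c G = ring c (G (suc k) 0) (G k 0) k (m ∸ k)
    where
    ring : ∀ c x y k M → (suc (suc k) * (c * x) + M * (c * y)) + 0 ≡ c * ((suc (suc k) * x + M * y) + 0)
    ring = ℕ-Solver.solve-∀
  step-* m (suc k) (suc j) c G = ring c (G (suc k) (suc j)) (G k (suc j)) (G (suc k) j) (G k j) k (m ∸ k) (suc m ∸ k)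
    where
    ring : ∀ c x y z w k M M′ → (suc (suc k) * (c * x) + M * (c * y)) + (suc k * (c * z) + M′ * (c * w))
                                ≡ c * ((suc (suc k) * x + M * y) + (suc k * z + M′ * w))
    ring = ℕ-Solver.solve-∀

  step-separable : ∀ m k j u (D N : ℕ → ℕ) →
    (u * N j) * (suc k * D k + atPred 0 k (λ k′ → (m ∸ k′) * D k′))
      + (u * atPred 0 j N) * (k * D k + atPred 0 k (λ k′ → (suc m ∸ k′) * D k′))
      ≡ step m (λ k′ j′ → u * (D k′ * N j′)) k j
  step-separable m zero zero u D N = ring u (D 0) (N 0)
    where
    ring : ∀ u a b → (u * b) * (1 * a + 0) + (u * 0) * (0 * a + 0) ≡ (1 * (u * (a * b)) + 0) + 0
    ring = ℕ-Solver.solve-∀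
  step-separable m zero (suc j) u D N = ring u (D 0) (N (suc j)) (N j)
    where
    ring : ∀ u a b c → (u * b) * (1 * a + 0) + (u * c) * (0 * a + 0) ≡ (1 * (u * (a * b)) + 0) + (0 * (u * (a * c)) + 0)
    ring = ℕ-Solver.solve-∀
  step-separable m (suc k) zero u D N = ring u (D (suc k)) (D k) (N 0) k (m ∸ k) (suc m ∸ k)
    where
    ring : ∀ u a a′ b k M M′ → (u * b) * (suc (suc k) * a + M * a′) + (u * 0) * (suc k * a + M′ * a′)
                               ≡ (suc (suc k) * (u * (a * b)) + M * (u * (a′ * b))) + 0
    ring = ℕ-Solver.solve-∀
  step-separable m (suc k) (suc j) u D N = ring u (D (suc k)) (D k) (N (suc j)) (N j) k (m ∸ k) (suc m ∸ k)
    where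
    ring : ∀ u a a′ b c k M M′ → (u * b) * (suc (suc k) * a + M * a′) + (u * c) * (suc k * a + M′ * a′)
      ≡ (suc (suc k) * (u * (a * b)) + M * (u * (a′ * b))) + (suc k * (u * (a * c)) + M′ * (u * (a′ * c)))
    ring = ℕ-Solver.solve-∀

  signedEulerian≡rhs : ∀ m k j → + signedEulerian m k j ≡ rhs m k j
  signedEulerian≡rhs zero zero zero = refl
  signedEulerian≡rhs zero zero (suc j) = refl
  signedEulerian≡rhs zero (suc k) (suc j) = refl
  signedEulerian≡rhs zero (suc k) zero = sym (begin
      rhs 0 (suc k) 0
    ≡⟨ rhs≡C*∇ 0 (suc k) 0 ⟩
      + 1 ℤ.* ∇ 1 (weight 0 0) (suc k)
    ≡⟨ ℤ.*-identityˡ _ ⟩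
      ∇ 1 (weight 0 0) (suc k)
    ≡⟨ ∇-suc 0 (weight 0 0) k ⟩
      ∇ 0 (weight 0 0) (suc k) ℤ.- ∇ 0 (weight 0 0) k
    ≡⟨ cong₂ ℤ._-_ (∇-zero (weight 0 0) (suc k)) (∇-zero (weight 0 0) k) ⟩
      + 1 ℤ.- + 1 ∎)
  signedEulerian≡rhs (suc m) k j = begin
      + step m (signedEulerian m) k j
    ≡⟨ pos-step m k j (signedEulerian m) signedEulerian-vanishes ⟩
      stepℤ m (λ k′ j′ → + signedEulerian m k′ j′) k j
    ≡⟨ stepℤ-cong m k j (signedEulerian≡rhs m) ⟩
      stepℤ m (rhs m) k j
    ≡⟨ sym (rhs-step m k j) ⟩
      rhs (suc m) k j ∎

module Counting where

  open import Data.Nat using (ℕ; zero; suc; _+_; _*_; _∸_; _≟_)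
  open import Data.Nat.Properties using (+-assoc; +-identityʳ; *-zeroʳ; *-distribˡ-+; suc-injective; m+n∸n≡m)
  import Data.Nat.Tactic.RingSolver as ℕ-Solver
  open import Data.List using (List; []; _∷_; _++_; map; concatMap; filter; length)
  open import Data.List.Relation.Unary.All using (All; []; _∷_)
  open import Data.Empty using (⊥-elim)
  open import Relation.Nullary using (Dec; yes; no; _×-dec_)
  open import Relation.Unary using (Decidable)
  open import Relation.Binary.PropositionalEquality

  sumMap : {A : Set} → (A → ℕ) → List A → ℕ
  sumMap F [] = 0
  sumMap F (x ∷ xs) = F x + sumMap F xs

  sumMap-cong : {A : Set} (xs : List A) {F G : A → ℕ} → (∀ x → F x ≡ G x) → sumMap F xs ≡ sumMap G xs
  sumMap-cong [] F≗G = refl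
  sumMap-cong (x ∷ xs) F≗G = cong₂ _+_ (F≗G x) (sumMap-cong xs F≗G)

  sumMap-+ : {A : Set} (xs : List A) (F G : A → ℕ) → sumMap (λ x → F x + G x) xs ≡ sumMap F xs + sumMap G xs
  sumMap-+ [] F G = refl
  sumMap-+ (x ∷ xs) F G rewrite sumMap-+ xs F G = interchange (F x) (G x) (sumMap F xs) (sumMap G xs)
    where
    interchange : ∀ a b c d → (a + b) + (c + d) ≡ (a + c) + (b + d)
    interchange = ℕ-Solver.solve-∀

  sumMap-* : {A : Set} (xs : List A) (c : ℕ) (F : A → ℕ) → sumMap (λ x → c * F x) xs ≡ c * sumMap F xs
  sumMap-* [] c F = sym (*-zeroʳ c)
  sumMap-* (x ∷ xs) c F rewrite sumMap-* xs c F = sym (*-distribˡ-+ c (F x) (sumMap F xs))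

  sumMap-zero : {A : Set} (xs : List A) (F : A → ℕ) → (∀ x → F x ≡ 0) → sumMap F xs ≡ 0
  sumMap-zero [] F F≗0 = refl
  sumMap-zero (x ∷ xs) F F≗0 rewrite F≗0 x = sumMap-zero xs F F≗0

  sumMap-congAll : {A : Set} {P : A → Set} (xs : List A) {F G : A → ℕ} → (∀ x → P x → F x ≡ G x) → All P xs →
    sumMap F xs ≡ sumMap G xs
  sumMap-congAll [] F≗G [] = refl
  sumMap-congAll (x ∷ xs) F≗G (px ∷ pxs) = cong₂ _+_ (F≗G x px) (sumMap-congAll xs F≗G pxs)

  sumMap-++ : {A : Set} (xs ys : List A) (F : A → ℕ) → sumMap F (xs ++ ys) ≡ sumMap F xs + sumMap F ys
  sumMap-++ [] ys F = refl
  sumMap-++ (x ∷ xs) ys F rewrite sumMap-++ xs ys F = sym (+-assoc (F x) (sumMap F xs) (sumMap F ys))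

  sumMap-map : {A B : Set} (f : A → B) (xs : List A) (F : B → ℕ) → sumMap F (map f xs) ≡ sumMap (λ x → F (f x)) xs
  sumMap-map f [] F = refl
  sumMap-map f (x ∷ xs) F = cong (_+_ (F (f x))) (sumMap-map f xs F)

  sumMap-concatMap : {A B : Set} (f : A → List B) (xs : List A) (F : B → ℕ) →
    sumMap F (concatMap f xs) ≡ sumMap (λ x → sumMap F (f x)) xs
  sumMap-concatMap f [] F = refl
  sumMap-concatMap f (x ∷ xs) F = trans (sumMap-++ (f x) (concatMap f xs) F) (cong (_+_ (sumMap F (f x))) (sumMap-concatMap f xs F))

  sumMap-atPred : {A : Set} (k : ℕ) (xs : List A) (F : ℕ → A → ℕ) →
    sumMap (λ x → atPred 0 k (λ i → F i x)) xs ≡ atPred 0 k (λ i → sumMap (F i) xs)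
  sumMap-atPred zero xs F = sumMap-zero xs _ (λ _ → refl)
  sumMap-atPred (suc k) xs F = refl

  indicator : {P : Set} → Dec P → ℕ
  indicator (yes _) = 1
  indicator (no _) = 0

  indicator-yes : {P : Set} (P? : Dec P) → P → indicator P? ≡ 1
  indicator-yes (yes _) _ = refl
  indicator-yes (no ¬p) p = ⊥-elim (¬p p)

  indicator-×-dec : {P Q : Set} (P? : Dec P) (Q? : Dec Q) → indicator (P? ×-dec Q?) ≡ indicator P? * indicator Q?
  indicator-×-dec (yes _) (yes _) = refl
  indicator-×-dec (yes _) (no _) = refl
  indicator-×-dec (no _) _ = refl

  indicator-⇔ : {P Q : Set} (P? : Dec P) (Q? : Dec Q) → (P → Q) → (Q → P) → indicator P? ≡ indicator Q?
  indicator-⇔ (yes _) (yes _) P→Q Q→P = refl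
  indicator-⇔ (yes p) (no ¬q) P→Q Q→P = ⊥-elim (¬q (P→Q p))
  indicator-⇔ (no ¬p) (yes q) P→Q Q→P = ⊥-elim (¬p (Q→P q))
  indicator-⇔ (no _) (no _) P→Q Q→P = refl

  sumMap-filter : {A : Set} {P : A → Set} (P? : Decidable P) (xs : List A) (F : A → ℕ) →
    sumMap F (filter P? xs) ≡ sumMap (λ x → indicator (P? x) * F x) xs
  sumMap-filter P? [] F = refl
  sumMap-filter P? (x ∷ xs) F with P? x
  ... | yes _ = cong₂ _+_ (sym (+-identityʳ (F x))) (sumMap-filter P? xs F)
  ... | no _ = sumMap-filter P? xs F

  length≡sumMap-1 : {A : Set} (xs : List A) → length xs ≡ sumMap (λ _ → 1) xs
  length≡sumMap-1 [] = refl
  length≡sumMap-1 (x ∷ xs) = cong suc (length≡sumMap-1 xs)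

  *-indicator-≟ : ∀ (f : ℕ → ℕ) d k → f d * indicator (d ≟ k) ≡ f k * indicator (d ≟ k)
  *-indicator-≟ f d k with d ≟ k
  ... | yes refl = refl
  ... | no _ = trans (*-zeroʳ (f d)) (sym (*-zeroʳ (f k)))

  indicator-suc-≟-suc : ∀ d k → indicator (suc d ≟ suc k) ≡ indicator (d ≟ k)
  indicator-suc-≟-suc d k = indicator-⇔ (suc d ≟ suc k) (d ≟ k) suc-injective (cong suc)

  indicator-suc-≟ : ∀ d k → indicator (suc d ≟ k) ≡ atPred 0 k (λ k′ → indicator (d ≟ k′))
  indicator-suc-≟ d zero = refl
  indicator-suc-≟ d (suc k) = indicator-suc-≟-suc d k

  *-indicator-suc-≟ : ∀ t d M k → t + d ≡ M → t * indicator (suc d ≟ k) ≡ atPred 0 k (λ k′ → (M ∸ k′) * indicator (d ≟ k′))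
  *-indicator-suc-≟ t d M zero t+d≡M = *-zeroʳ t
  *-indicator-suc-≟ t d M (suc k) t+d≡M rewrite indicator-suc-≟-suc d k with d ≟ k
  ... | yes refl = cong (_* 1) (sym (trans (cong (_∸ d) (sym t+d≡M)) (m+n∸n≡m t d)))
  ... | no _ = trans (*-zeroʳ t) (sym (*-zeroʳ (M ∸ k)))

module WindowCount where

  open Counting
  open import Data.Nat using (ℕ; suc; _*_; _≟_)
  open import Data.Nat.Properties using (*-identityʳ)
  open import Data.Integer using (ℤ; ∣_∣)
  open import Data.List using (List; _∷_; map; filter; length)
  open import Data.Product using (_×_)
  open import Data.List.Relation.Unary.Unique.Propositional using (Unique)
  open import Data.List.Relation.Unary.Unique.DecPropositional Data.Nat._≟_ using (unique?)
  open import Relation.Nullary using (Dec; _×-dec_)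
  open import Relation.Binary.PropositionalEquality

  sumMap-words-suc : (A : List ℤ) (m : ℕ) (F : List ℤ → ℕ) →
    sumMap F (words A (suc m)) ≡ sumMap (λ w → sumMap (λ x → F (x ∷ w)) A) (words A m)
  sumMap-words-suc A m F =
    trans (sumMap-concatMap _ (words A m) F) (sumMap-cong (words A m) (λ w → sumMap-map (_∷ w) A F))

  distinctAbs? : (w : List ℤ) → Dec (Unique (map ∣_∣ w))
  distinctAbs? w = unique? (map ∣_∣ w)

  χ : ℕ → ℕ → List ℤ → ℕ
  χ k j w = indicator (distinctAbs? w) * (indicator (des w ≟ k) * indicator (neg w ≟ j))

  countWords : ℕ → ℕ → ℕ → ℕ → ℕ
  countWords n m k j = sumMap (χ k j) (words (nonzeroValues n) m)

  B≡countWords : ∀ n k j → B n k j ≡ countWords n n k j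
  B≡countWords n k j = begin
      length (filter stats? (filter distinctAbs? ws))
    ≡⟨ length≡sumMap-1 (filter stats? (filter distinctAbs? ws)) ⟩
      sumMap (λ _ → 1) (filter stats? (filter distinctAbs? ws))
    ≡⟨ sumMap-filter stats? (filter distinctAbs? ws) (λ _ → 1) ⟩
      sumMap (λ w → indicator (stats? w) * 1) (filter distinctAbs? ws)
    ≡⟨ sumMap-filter distinctAbs? ws _ ⟩
      sumMap (λ w → indicator (distinctAbs? w) * (indicator (stats? w) * 1)) ws
    ≡⟨ sumMap-cong ws (λ w → cong (indicator (distinctAbs? w) *_)
         (trans (*-identityʳ _) (indicator-×-dec (des w ≟ k) (neg w ≟ j)))) ⟩
      countWords n n k j ∎
    where
    open ≡-Reasoning
    ws = words (nonzeroValues n) n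
    stats? : (w : List ℤ) → Dec (des w ≡ k × neg w ≡ j)
    stats? w = (des w ≟ k) ×-dec (neg w ≟ j)

module Insertion where

  open Counting
  open WindowCount
  open InsertionRecurrence using (step⁺; step⁻; step)
  open import Data.Nat using (ℕ; zero; suc; _+_; _*_; _∸_; _≤_; s≤s; _≟_)
  open import Data.Nat.Properties using (≤-trans; ≤-reflexive; m≤m+n; m≤n+m; +-identityʳ; +-assoc; *-distribˡ-+)
  import Data.Nat.Tactic.RingSolver as ℕ-Solver
  open import Data.Integer using (ℤ; +_; +[1+_]; -[1+_]; ∣_∣)
  open import Data.List using (List; []; _∷_; _++_; map; upTo)
  open import Data.List.Properties using (applyUpTo-∷ʳ; map-++)
  open import Relation.Binary.PropositionalEquality
  open ≡-Reasoning

  sumUpTo : ℕ → (ℕ → ℕ) → ℕ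
  sumUpTo zero f = f 0
  sumUpTo (suc p) f = f 0 + sumUpTo p (λ q → f (suc q))

  sumUpTo-cong : ∀ p {f g : ℕ → ℕ} → (∀ q → f q ≡ g q) → sumUpTo p f ≡ sumUpTo p g
  sumUpTo-cong zero f≗g = f≗g 0
  sumUpTo-cong (suc p) f≗g = cong₂ _+_ (f≗g 0) (sumUpTo-cong p (λ q → f≗g (suc q)))

  sumUpTo-+ : ∀ p (f g : ℕ → ℕ) → sumUpTo p (λ q → f q + g q) ≡ sumUpTo p f + sumUpTo p g
  sumUpTo-+ zero f g = refl
  sumUpTo-+ (suc p) f g rewrite sumUpTo-+ p (λ q → f (suc q)) (λ q → g (suc q)) =
    interchange (f 0) (g 0) (sumUpTo p (λ q → f (suc q))) (sumUpTo p (λ q → g (suc q)))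
    where
    interchange : ∀ a b c d → (a + b) + (c + d) ≡ (a + c) + (b + d)
    interchange = ℕ-Solver.solve-∀

  sumUpTo-* : ∀ p c (f : ℕ → ℕ) → sumUpTo p (λ q → c * f q) ≡ c * sumUpTo p f
  sumUpTo-* zero c f = refl
  sumUpTo-* (suc p) c f rewrite sumUpTo-* p c (λ q → f (suc q)) = sym (*-distribˡ-+ c (f 0) _)

  sumUpTo-sumMap : ∀ p {A : Set} (xs : List A) (F : A → ℕ → ℕ) →
    sumUpTo p (λ q → sumMap (λ x → F x q) xs) ≡ sumMap (λ x → sumUpTo p (F x)) xs
  sumUpTo-sumMap zero xs F = refl
  sumUpTo-sumMap (suc p) xs F =
    trans (cong (_+_ (sumMap (λ x → F x 0) xs)) (sumUpTo-sumMap p xs (λ x q → F x (suc q)))) (sym (sumMap-+ xs _ _))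

  insertAt : ℕ → ℤ → List ℤ → List ℤ
  insertAt zero c v = c ∷ v
  insertAt (suc q) c [] = c ∷ []
  insertAt (suc q) c (x ∷ v) = x ∷ insertAt q c v

  sumMap-step : {A : Set} (xs : List A) (m k j : ℕ) (G : ℕ → ℕ → A → ℕ) →
    sumMap (λ x → step m (λ k′ j′ → G k′ j′ x) k j) xs ≡ step m (λ k′ j′ → sumMap (G k′ j′) xs) k j
  sumMap-step xs m k j G = trans (sumMap-+ xs _ _) (cong₂ _+_ (sumMap-step⁺ j)
    (trans (sumMap-atPred j xs _) (atPred-cong j sumMap-step⁻)))
    where
    sumMap-step⁺ : ∀ j → sumMap (λ x → step⁺ m (λ k′ j′ → G k′ j′ x) k j) xs ≡ step⁺ m (λ k′ j′ → sumMap (G k′ j′) xs) k j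
    sumMap-step⁺ j = trans (sumMap-+ xs _ _) (cong₂ _+_ (sumMap-* xs (suc k) (G k j))
      (trans (sumMap-atPred k xs _) (atPred-cong k (λ k′ → sumMap-* xs (m ∸ k′) (G k′ j)))))
    sumMap-step⁻ : ∀ j → sumMap (λ x → step⁻ m (λ k′ j′ → G k′ j′ x) k j) xs ≡ step⁻ m (λ k′ j′ → sumMap (G k′ j′) xs) k j
    sumMap-step⁻ j = trans (sumMap-+ xs _ _) (cong₂ _+_ (sumMap-* xs k (G k j))
      (trans (sumMap-atPred k xs _) (atPred-cong k (λ k′ → sumMap-* xs (suc m ∸ k′) (G k′ j)))))

  module TopLetters (n : ℕ) where

    top bottom : ℤ
    top = + suc n
    bottom = -[1+ n ]

    sumMap-nonzeroValues-suc : ∀ (g : ℤ → ℕ) →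
      sumMap g (nonzeroValues (suc n)) ≡ sumMap g (nonzeroValues n) + (g top + g bottom)
    sumMap-nonzeroValues-suc g = begin
        sumMap g (positives (suc n) ++ negatives (suc n))
      ≡⟨ sumMap-++ (positives (suc n)) (negatives (suc n)) g ⟩
        sumMap g (positives (suc n)) + sumMap g (negatives (suc n))
      ≡⟨ cong₂ _+_ (last-letter +[1+_]) (last-letter -[1+_]) ⟩
        (sumMap g (positives n) + (g top + 0)) + (sumMap g (negatives n) + (g bottom + 0))
      ≡⟨ interchange (sumMap g (positives n)) (sumMap g (negatives n)) (g top) (g bottom) ⟩
        (sumMap g (positives n) + sumMap g (negatives n)) + (g top + g bottom)
      ≡⟨ cong (_+ (g top + g bottom)) (sym (sumMap-++ (positives n) (negatives n) g)) ⟩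
        sumMap g (nonzeroValues n) + (g top + g bottom) ∎
      where
      positives negatives : ℕ → List ℤ
      positives N = map +[1+_] (upTo N)
      negatives N = map -[1+_] (upTo N)
      last-letter : ∀ (f : ℕ → ℤ) → sumMap g (map f (upTo (suc n))) ≡ sumMap g (map f (upTo n)) + (g (f n) + 0)
      last-letter f = begin
          sumMap g (map f (upTo (suc n)))
        ≡⟨ cong (λ xs → sumMap g (map f xs)) (sym (applyUpTo-∷ʳ (λ i → i) n)) ⟩
          sumMap g (map f (upTo n ++ n ∷ []))
        ≡⟨ cong (sumMap g) (map-++ f (upTo n) (n ∷ [])) ⟩
          sumMap g (map f (upTo n) ++ f n ∷ [])
        ≡⟨ sumMap-++ (map f (upTo n)) (f n ∷ []) g ⟩
          sumMap g (map f (upTo n)) + (g (f n) + 0) ∎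
      interchange : ∀ a b c d → (a + (c + 0)) + (b + (d + 0)) ≡ (a + b) + (c + d)
      interchange = ℕ-Solver.solve-∀

    #tops : List ℤ → ℕ
    #tops [] = 0
    #tops (x ∷ w) = indicator (∣ x ∣ ≟ suc n) + #tops w

    VanishesOnTwoTops : (List ℤ → ℕ) → Set
    VanishesOnTwoTops F = ∀ w → 2 ≤ #tops w → F w ≡ 0

    #tops-insertAt : ∀ q c v → ∣ c ∣ ≡ suc n → 1 ≤ #tops (insertAt q c v)
    #tops-insertAt zero c v ∣c∣≡1+n = ≤-trans (≤-reflexive (sym (indicator-yes (∣ c ∣ ≟ suc n) ∣c∣≡1+n))) (m≤m+n _ (#tops v))
    #tops-insertAt (suc q) c [] ∣c∣≡1+n = ≤-trans (≤-reflexive (sym (indicator-yes (∣ c ∣ ≟ suc n) ∣c∣≡1+n))) (m≤m+n _ 0)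
    #tops-insertAt (suc q) c (x ∷ v) ∣c∣≡1+n = ≤-trans (#tops-insertAt q c v ∣c∣≡1+n) (m≤n+m _ _)

    vanishes-insertAt : ∀ {F} → VanishesOnTwoTops F → ∀ {y} q {c} v → ∣ y ∣ ≡ suc n → ∣ c ∣ ≡ suc n → F (y ∷ insertAt q c v) ≡ 0
    vanishes-insertAt F-vanishes {y} q {c} v ∣y∣≡1+n ∣c∣≡1+n = F-vanishes _ (≤-trans (s≤s (#tops-insertAt q c v ∣c∣≡1+n))
      (≤-reflexive (cong (_+ #tops (insertAt q c v)) (sym (indicator-yes (∣ y ∣ ≟ suc n) ∣y∣≡1+n)))))

    sumInsertions : ℕ → (List ℤ → ℕ) → List ℤ → ℕ
    sumInsertions m F v = sumUpTo m (λ q → F (insertAt q top v) + F (insertAt q bottom v))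

    -- Peeling off the first letter: if it is ±(n + 1), the rest is a word over ±[n];
    -- otherwise the letter ±(n + 1), if any, sits in the rest and induction applies.
    decompose : ∀ m F → VanishesOnTwoTops F →
      sumMap F (words (nonzeroValues (suc n)) (suc m))
        ≡ sumMap F (words (nonzeroValues n) (suc m)) + sumMap (sumInsertions m F) (words (nonzeroValues n) m)
    decompose zero F F-vanishes = begin
        sumMap F (words A′ 1)
      ≡⟨ sumMap-words-suc A′ 0 F ⟩
        sumMap (λ x → F (x ∷ [])) A′ + 0
      ≡⟨ cong (_+ 0) (sumMap-nonzeroValues-suc _) ⟩
        (sumMap (λ x → F (x ∷ [])) A + (F (top ∷ []) + F (bottom ∷ []))) + 0
      ≡⟨ shuffle (sumMap (λ x → F (x ∷ [])) A) (F (top ∷ []) + F (bottom ∷ [])) ⟩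
        (sumMap (λ x → F (x ∷ [])) A + 0) + ((F (top ∷ []) + F (bottom ∷ [])) + 0)
      ≡⟨ cong (_+ ((F (top ∷ []) + F (bottom ∷ [])) + 0)) (sym (sumMap-words-suc A 0 F)) ⟩
        sumMap F (words A 1) + sumMap (sumInsertions 0 F) (words A 0) ∎
      where
      A A′ : List ℤ
      A = nonzeroValues n
      A′ = nonzeroValues (suc n)
      shuffle : ∀ a b → (a + b) + 0 ≡ (a + 0) + (b + 0)
      shuffle = ℕ-Solver.solve-∀
    decompose (suc m) F F-vanishes = begin
        sumMap F (words A′ (suc (suc m)))
      ≡⟨ sumMap-words-suc A′ (suc m) F ⟩
        sumMap F′ (words A′ (suc m))
      ≡⟨ decompose m F′ F′-vanishes ⟩
        sumMap F′ (words A (suc m)) + sumMap (sumInsertions m F′) (words A m)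
      ≡⟨ cong₂ _+_ first-letter-old first-letter-new ⟩
        (sumMap F (words A (suc (suc m))) + sumMap head (words A (suc m))) + sumMap tail (words A (suc m))
      ≡⟨ +-assoc (sumMap F (words A (suc (suc m)))) _ _ ⟩
        sumMap F (words A (suc (suc m))) + (sumMap head (words A (suc m)) + sumMap tail (words A (suc m)))
      ≡⟨ cong (_+_ (sumMap F (words A (suc (suc m))))) (sym (sumMap-+ (words A (suc m)) head tail)) ⟩
        sumMap F (words A (suc (suc m))) + sumMap (sumInsertions (suc m) F) (words A (suc m)) ∎
      where
      A A′ : List ℤ
      A = nonzeroValues n
      A′ = nonzeroValues (suc n)
      F′ head tail : List ℤ → ℕ
      F′ w = sumMap (λ x → F (x ∷ w)) A′
      head w = F (top ∷ w) + F (bottom ∷ w)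
      tail w = sumUpTo m (λ q → F (insertAt (suc q) top w) + F (insertAt (suc q) bottom w))
      F′-vanishes : VanishesOnTwoTops F′
      F′-vanishes w two = sumMap-zero A′ _ (λ x → F-vanishes (x ∷ w) (≤-trans two (m≤n+m _ _)))
      first-letter-old : sumMap F′ (words A (suc m)) ≡ sumMap F (words A (suc (suc m))) + sumMap head (words A (suc m))
      first-letter-old = trans (sumMap-cong (words A (suc m)) (λ w → sumMap-nonzeroValues-suc (λ x → F (x ∷ w))))
        (trans (sumMap-+ (words A (suc m)) _ head) (cong (_+ sumMap head (words A (suc m))) (sym (sumMap-words-suc A (suc m) F))))
      F′-insertAt : ∀ q {c} v → ∣ c ∣ ≡ suc n → F′ (insertAt q c v) ≡ sumMap (λ x → F (x ∷ insertAt q c v)) A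
      F′-insertAt q {c} v ∣c∣≡1+n = trans (sumMap-nonzeroValues-suc (λ x → F (x ∷ insertAt q c v)))
        (trans (cong₂ (λ a b → sumMap (λ x → F (x ∷ insertAt q c v)) A + (a + b))
                      (vanishes-insertAt F-vanishes q v refl ∣c∣≡1+n) (vanishes-insertAt F-vanishes q v refl ∣c∣≡1+n))
               (+-identityʳ _))
      first-letter-new : sumMap (sumInsertions m F′) (words A m) ≡ sumMap tail (words A (suc m))
      first-letter-new = trans (sumMap-cong (words A m) (λ v →
          trans (sumUpTo-cong m (λ q → trans (cong₂ _+_ (F′-insertAt q v refl) (F′-insertAt q v refl)) (sym (sumMap-+ A _ _))))
                (sumUpTo-sumMap m A (λ x q → F (x ∷ insertAt q top v) + F (x ∷ insertAt q bottom v)))))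
        (sym (sumMap-words-suc A m tail))

module InsertionStatistics (n : ℕ) where

  open Counting
  open WindowCount
  open Insertion
  open TopLetters n
  open InsertionRecurrence using (step; step-separable)
  open import Data.Nat using (ℕ; zero; suc; _+_; _*_; _∸_; _≤_; z≤n; s≤s; _≟_)
  open import Data.Nat.Properties using (+-suc; suc-injective; <-irrefl; ≤-trans)
  import Data.Nat.Tactic.RingSolver as ℕ-Solver
  open import Data.Integer using (ℤ; +_; -[1+_]; ∣_∣; _<_; _<?_; -<+; -<-; +<+)
  open import Data.Integer.Properties using (<-asym)
  open import Data.List using ([]; _∷_; map; length)
  open import Data.List.Relation.Unary.All as All using (All; []; _∷_)
  open import Data.List.Relation.Unary.All.Properties using (map⁺; ++⁺; concat⁺; applyUpTo⁺₁)
  open import Data.List.Relation.Unary.AllPairs using ([]; _∷_)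
  open import Data.List.Relation.Unary.Unique.Propositional using (Unique)
  open import Data.Product using (_×_; _,_; ∃; proj₁; proj₂)
  open import Data.Empty using (⊥-elim)
  open import Relation.Nullary using (yes; no; ¬_)
  open import Relation.Binary.PropositionalEquality
  open ≡-Reasoning

  InRange : ℤ → Set
  InRange x = bottom < x × x < top

  0-inRange : InRange (+ 0)
  0-inRange = -<+ , +<+ (s≤s z≤n)

  nonzeroValues-inRange : All InRange (nonzeroValues n)
  nonzeroValues-inRange = ++⁺ (map⁺ (applyUpTo⁺₁ (λ i → i) n (λ i<n → -<+ , +<+ (s≤s i<n))))
                              (map⁺ (applyUpTo⁺₁ (λ i → i) n (λ i<n → -<- i<n , -<+)))

  words-inRange : ∀ m → All (λ w → length w ≡ m × All InRange w) (words (nonzeroValues n) m)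
  words-inRange zero = (refl , []) ∷ []
  words-inRange (suc m) = concat⁺ (map⁺ (All.map (λ (∣w∣≡m , w-inRange) →
    map⁺ (All.map (λ x-inRange → cong suc ∣w∣≡m , x-inRange ∷ w-inRange) nonzeroValues-inRange)) (words-inRange m)))

  inRange⇒∣∣≢1+n : ∀ {x} → InRange x → ∣ x ∣ ≢ suc n
  inRange⇒∣∣≢1+n {+ m} (_ , +<+ m<1+n) ∣x∣≡1+n = <-irrefl ∣x∣≡1+n m<1+n
  inRange⇒∣∣≢1+n { -[1+ m ]} (-<- m<n , _) ∣x∣≡1+n = <-irrefl (suc-injective ∣x∣≡1+n) m<n

  All-insertAt⁻ : ∀ {Q : ℕ → Set} q c v → All Q (map ∣_∣ (insertAt q c v)) → All Q (map ∣_∣ v)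
  All-insertAt⁻ zero c v (_ ∷ qv) = qv
  All-insertAt⁻ (suc q) c [] _ = []
  All-insertAt⁻ (suc q) c (x ∷ v) (qx ∷ qv) = qx ∷ All-insertAt⁻ q c v qv

  All-insertAt⁺ : ∀ {Q : ℕ → Set} q c v → All Q (map ∣_∣ v) → Q ∣ c ∣ → All Q (map ∣_∣ (insertAt q c v))
  All-insertAt⁺ zero c v qv qc = qc ∷ qv
  All-insertAt⁺ (suc q) c [] qv qc = qc ∷ []
  All-insertAt⁺ (suc q) c (x ∷ v) (qx ∷ qv) qc = qx ∷ All-insertAt⁺ q c v qv qc

  distinct-insertAt⁻ : ∀ q c v → Unique (map ∣_∣ (insertAt q c v)) → Unique (map ∣_∣ v)
  distinct-insertAt⁻ zero c v (_ ∷ dv) = dv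
  distinct-insertAt⁻ (suc q) c [] _ = []
  distinct-insertAt⁻ (suc q) c (x ∷ v) (x∉ ∷ dv) = All-insertAt⁻ q c v x∉ ∷ distinct-insertAt⁻ q c v dv

  distinct-insertAt⁺ : ∀ q c v → ∣ c ∣ ≡ suc n → All InRange v → Unique (map ∣_∣ v) → Unique (map ∣_∣ (insertAt q c v))
  distinct-insertAt⁺ zero c v ∣c∣≡1+n v-inRange dv =
    map⁺ (All.map (λ x-inRange ∣c∣≡∣x∣ → inRange⇒∣∣≢1+n x-inRange (trans (sym ∣c∣≡∣x∣) ∣c∣≡1+n)) v-inRange) ∷ dv
  distinct-insertAt⁺ (suc q) c [] ∣c∣≡1+n v-inRange dv = [] ∷ []
  distinct-insertAt⁺ (suc q) c (x ∷ v) ∣c∣≡1+n (x-inRange ∷ v-inRange) (x∉ ∷ dv) =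
    All-insertAt⁺ q c v x∉ (λ ∣x∣≡∣c∣ → inRange⇒∣∣≢1+n x-inRange (trans ∣x∣≡∣c∣ ∣c∣≡1+n)) ∷ distinct-insertAt⁺ q c v ∣c∣≡1+n v-inRange dv

  indicator-distinctAbs-insertAt : ∀ q c v → ∣ c ∣ ≡ suc n → All InRange v →
    indicator (distinctAbs? (insertAt q c v)) ≡ indicator (distinctAbs? v)
  indicator-distinctAbs-insertAt q c v ∣c∣≡1+n v-inRange = indicator-⇔ (distinctAbs? (insertAt q c v)) (distinctAbs? v)
    (distinct-insertAt⁻ q c v) (distinct-insertAt⁺ q c v ∣c∣≡1+n v-inRange)

  neg-insertAt-top : ∀ q v → neg (insertAt q top v) ≡ neg v
  neg-insertAt-top zero v = refl
  neg-insertAt-top (suc q) [] = refl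
  neg-insertAt-top (suc q) (x ∷ v) = cong (_+_ _) (neg-insertAt-top q v)

  neg-insertAt-bottom : ∀ q v → neg (insertAt q bottom v) ≡ suc (neg v)
  neg-insertAt-bottom zero v = refl
  neg-insertAt-bottom (suc q) [] = refl
  neg-insertAt-bottom (suc q) (x ∷ v) = trans (cong (_+_ _) (neg-insertAt-bottom q v)) (+-suc _ (neg v))

  des-insertAt-top : ∀ prev v → InRange prev → All InRange v → (φ : ℕ → ℕ) → ∃ λ t → t + desFrom prev v ≡ length v ×
    sumUpTo (length v) (λ q → φ (desFrom prev (insertAt q top v)))
      ≡ suc (desFrom prev v) * φ (desFrom prev v) + t * φ (suc (desFrom prev v))
  des-insertAt-top prev [] prev-inRange [] φ with top <? prev
  ... | yes top<prev = ⊥-elim (<-asym top<prev (proj₂ prev-inRange))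
  ... | no _ = 0 , refl , only (φ 0) (φ 1)
    where
    only : ∀ a b → a ≡ 1 * a + 0 * b
    only = ℕ-Solver.solve-∀
  des-insertAt-top prev (x ∷ v) prev-inRange (x-inRange ∷ v-inRange) φ with top <? prev | x <? top
  ... | yes top<prev | _ = ⊥-elim (<-asym top<prev (proj₂ prev-inRange))
  ... | no _ | no x≮top = ⊥-elim (x≮top (proj₂ x-inRange))
  ... | no _ | yes _ with x <? prev
  ...   | yes _ with des-insertAt-top x v x-inRange v-inRange (λ d → φ (suc d))
  ...     | t , t+d≡∣v∣ , sum≡ = t , trans (+-suc t _) (cong suc t+d≡∣v∣) ,
              trans (cong (_+_ (φ (suc d))) sum≡) (collect (φ (suc d)) d t (φ (suc (suc d))))
    where
    d = desFrom x v
    collect : ∀ a d t b → a + (suc d * a + t * b) ≡ suc (suc d) * a + t * b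
    collect = ℕ-Solver.solve-∀
  des-insertAt-top prev (x ∷ v) prev-inRange (x-inRange ∷ v-inRange) φ | no _ | yes _ | no _
    with des-insertAt-top x v x-inRange v-inRange φ
  ... | t , t+d≡∣v∣ , sum≡ = suc t , cong suc t+d≡∣v∣ ,
          trans (cong (_+_ (φ (suc d))) sum≡) (collect (φ (suc d)) d t (φ d))
    where
    d = desFrom x v
    collect : ∀ a d t b → a + (suc d * b + t * a) ≡ suc d * b + suc t * a
    collect = ℕ-Solver.solve-∀

  des-insertAt-bottom : ∀ prev v → InRange prev → All InRange v → (φ : ℕ → ℕ) → ∃ λ t → t + desFrom prev v ≡ suc (length v) ×
    sumUpTo (length v) (λ q → φ (desFrom prev (insertAt q bottom v)))
      ≡ desFrom prev v * φ (desFrom prev v) + t * φ (suc (desFrom prev v))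
  des-insertAt-bottom prev [] prev-inRange [] φ with bottom <? prev
  ... | no bottom≮prev = ⊥-elim (bottom≮prev (proj₁ prev-inRange))
  ... | yes _ = 1 , refl , only (φ 0) (φ 1)
    where
    only : ∀ a b → b ≡ 0 * a + 1 * b
    only = ℕ-Solver.solve-∀
  des-insertAt-bottom prev (x ∷ v) prev-inRange (x-inRange ∷ v-inRange) φ with bottom <? prev | x <? bottom
  ... | no bottom≮prev | _ = ⊥-elim (bottom≮prev (proj₁ prev-inRange))
  ... | yes _ | yes x<bottom = ⊥-elim (<-asym x<bottom (proj₁ x-inRange))
  ... | yes _ | no _ with x <? prev
  ...   | yes _ with des-insertAt-bottom x v x-inRange v-inRange (λ d → φ (suc d))
  ...     | t , t+d≡1+∣v∣ , sum≡ = t , trans (+-suc t _) (cong suc t+d≡1+∣v∣) ,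
              trans (cong (_+_ (φ (suc d))) sum≡) (collect (φ (suc d)) d t (φ (suc (suc d))))
    where
    d = desFrom x v
    collect : ∀ a d t b → a + (d * a + t * b) ≡ suc d * a + t * b
    collect = ℕ-Solver.solve-∀
  des-insertAt-bottom prev (x ∷ v) prev-inRange (x-inRange ∷ v-inRange) φ | yes _ | no _ | no _
    with des-insertAt-bottom x v x-inRange v-inRange φ
  ... | t , t+d≡1+∣v∣ , sum≡ = suc t , cong suc t+d≡1+∣v∣ ,
          trans (cong (_+_ (φ (suc d))) sum≡) (collect (φ (suc d)) d t (φ d))
    where
    d = desFrom x v
    collect : ∀ a d t b → a + (d * b + t * a) ≡ d * b + suc t * a
    collect = ℕ-Solver.solve-∀

  sumInsertions-χ : ∀ v → All InRange v → ∀ k j → sumInsertions (length v) (χ k j) v ≡ step (length v) (λ k′ j′ → χ k′ j′ v) k j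
  sumInsertions-χ v v-inRange k j = begin
      sumInsertions m (χ k j) v
    ≡⟨ sumUpTo-+ m _ _ ⟩
      sumUpTo m (λ q → χ k j (insertAt q top v)) + sumUpTo m (λ q → χ k j (insertAt q bottom v))
    ≡⟨ cong₂ _+_ top-half bottom-half ⟩
      (u * N j) * (suc k * D k + atPred 0 k (λ k′ → (m ∸ k′) * D k′))
        + (u * atPred 0 j N) * (k * D k + atPred 0 k (λ k′ → (suc m ∸ k′) * D k′))
    ≡⟨ step-separable m k j u D N ⟩
      step m (λ k′ j′ → χ k′ j′ v) k j ∎
    where
    m = length v
    d = des v
    u = indicator (distinctAbs? v)
    D N isK : ℕ → ℕ
    D k′ = indicator (d ≟ k′)
    N j′ = indicator (neg v ≟ j′)
    isK d′ = indicator (d′ ≟ k)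
    rearrange : ∀ u a b → u * (a * b) ≡ (u * b) * a
    rearrange = ℕ-Solver.solve-∀
    χ-top : ∀ q → χ k j (insertAt q top v) ≡ (u * N j) * isK (des (insertAt q top v))
    χ-top q rewrite indicator-distinctAbs-insertAt q top v refl v-inRange | neg-insertAt-top q v =
      rearrange u (isK (des (insertAt q top v))) (N j)
    χ-bottom : ∀ q → χ k j (insertAt q bottom v) ≡ (u * atPred 0 j N) * isK (des (insertAt q bottom v))
    χ-bottom q rewrite indicator-distinctAbs-insertAt q bottom v refl v-inRange | neg-insertAt-bottom q v
                     | indicator-suc-≟ (neg v) j =
      rearrange u (isK (des (insertAt q bottom v))) (atPred 0 j N)
    top-half : sumUpTo m (λ q → χ k j (insertAt q top v)) ≡ (u * N j) * (suc k * D k + atPred 0 k (λ k′ → (m ∸ k′) * D k′))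
    top-half with des-insertAt-top (+ 0) v 0-inRange v-inRange isK
    ... | t , t+d≡m , sum≡ = begin
        sumUpTo m (λ q → χ k j (insertAt q top v))
      ≡⟨ trans (sumUpTo-cong m χ-top) (sumUpTo-* m (u * N j) _) ⟩
        (u * N j) * sumUpTo m (λ q → isK (des (insertAt q top v)))
      ≡⟨ cong ((u * N j) *_) (trans sum≡ (cong₂ _+_ (*-indicator-≟ suc d k) (*-indicator-suc-≟ t d m k t+d≡m))) ⟩
        (u * N j) * (suc k * D k + atPred 0 k (λ k′ → (m ∸ k′) * D k′)) ∎
    bottom-half : sumUpTo m (λ q → χ k j (insertAt q bottom v))
                    ≡ (u * atPred 0 j N) * (k * D k + atPred 0 k (λ k′ → (suc m ∸ k′) * D k′))
    bottom-half with des-insertAt-bottom (+ 0) v 0-inRange v-inRange isK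
    ... | t , t+d≡1+m , sum≡ = begin
        sumUpTo m (λ q → χ k j (insertAt q bottom v))
      ≡⟨ trans (sumUpTo-cong m χ-bottom) (sumUpTo-* m (u * atPred 0 j N) _) ⟩
        (u * atPred 0 j N) * sumUpTo m (λ q → isK (des (insertAt q bottom v)))
      ≡⟨ cong ((u * atPred 0 j N) *_) (trans sum≡ (cong₂ _+_ (*-indicator-≟ (λ x → x) d k) (*-indicator-suc-≟ t d (suc m) k t+d≡1+m))) ⟩
        (u * atPred 0 j N) * (k * D k + atPred 0 k (λ k′ → (suc m ∸ k′) * D k′)) ∎

  #tops≡0 : ∀ w → All (λ y → ¬ suc n ≡ y) (map ∣_∣ w) → #tops w ≡ 0
  #tops≡0 [] _ = refl
  #tops≡0 (y ∷ w) (1+n≢∣y∣ ∷ rest) with ∣ y ∣ ≟ suc n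
  ... | yes ∣y∣≡1+n = ⊥-elim (1+n≢∣y∣ (sym ∣y∣≡1+n))
  ... | no _ = #tops≡0 w rest

  #tops≤1 : ∀ w → Unique (map ∣_∣ w) → #tops w ≤ 1
  #tops≤1 [] _ = z≤n
  #tops≤1 (x ∷ w) (x∉ ∷ dw) with ∣ x ∣ ≟ suc n
  ... | yes ∣x∣≡1+n rewrite #tops≡0 w (subst (λ z → All (λ y → ¬ z ≡ y) (map ∣_∣ w)) ∣x∣≡1+n x∉) = s≤s z≤n
  ... | no _ = #tops≤1 w dw

  χ-vanishesOnTwoTops : ∀ k j → VanishesOnTwoTops (χ k j)
  χ-vanishesOnTwoTops k j w two with distinctAbs? w
  ... | yes dw with ≤-trans two (#tops≤1 w dw)
  ...   | s≤s ()
  χ-vanishesOnTwoTops k j w two | no _ = refl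

  countWords-suc : ∀ m k j → countWords (suc n) (suc m) k j ≡ countWords n (suc m) k j + step m (countWords n m) k j
  countWords-suc m k j = begin
      countWords (suc n) (suc m) k j
    ≡⟨ decompose m (χ k j) (χ-vanishesOnTwoTops k j) ⟩
      countWords n (suc m) k j + sumMap (sumInsertions m (χ k j)) ws
    ≡⟨ cong (_+_ (countWords n (suc m) k j)) (sumMap-congAll ws (λ v (∣v∣≡m , v-inRange) →
         subst (λ m′ → sumInsertions m′ (χ k j) v ≡ step m′ (λ k′ j′ → χ k′ j′ v) k j) ∣v∣≡m (sumInsertions-χ v v-inRange k j))
         (words-inRange m)) ⟩
      countWords n (suc m) k j + sumMap (λ v → step m (λ k′ j′ → χ k′ j′ v) k j) ws
    ≡⟨ cong (_+_ (countWords n (suc m) k j)) (sumMap-step ws m k j χ) ⟩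
      countWords n (suc m) k j + step m (countWords n m) k j ∎
    where
    ws = words (nonzeroValues n) m

module CountWordsFormula where

  open Counting
  open WindowCount
  open InsertionRecurrence
  open import Data.Nat using (ℕ; zero; suc; _+_; _*_)
  open import Data.Nat.Properties using (+-identityʳ; *-distribʳ-+; +-comm)
  open import Data.Nat.Combinatorics using (_C_; nCk+nC[k+1]≡[n+1]C[k+1])
  open import Data.List using ([])
  open import Relation.Binary.PropositionalEquality
  open ≡-Reasoning

  countWords≡C*signedEulerian : ∀ n m k j → countWords n m k j ≡ (n C m) * signedEulerian m k j
  countWords≡C*signedEulerian n zero k j = trans (empty-word k j) (sym (+-identityʳ _))
    where
    empty-word : ∀ k j → χ k j [] + 0 ≡ signedEulerian 0 k j
    empty-word zero zero = refl
    empty-word zero (suc j) = refl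
    empty-word (suc k) j = refl
  countWords≡C*signedEulerian zero (suc m) k j = trans (sumMap-words-suc [] m (χ k j)) (sumMap-zero (words [] m) _ (λ _ → refl))
  countWords≡C*signedEulerian (suc n) (suc m) k j = begin
      countWords (suc n) (suc m) k j
    ≡⟨ InsertionStatistics.countWords-suc n m k j ⟩
      countWords n (suc m) k j + step m (countWords n m) k j
    ≡⟨ cong₂ _+_ (countWords≡C*signedEulerian n (suc m) k j)
         (trans (step-cong m k j (countWords≡C*signedEulerian n m)) (step-* m k j (n C m) (signedEulerian m))) ⟩
      (n C suc m) * E + (n C m) * E
    ≡⟨ sym (*-distribʳ-+ E (n C suc m) (n C m)) ⟩
      (n C suc m + n C m) * E
    ≡⟨ cong (_* E) (trans (+-comm (n C suc m) (n C m)) (nCk+nC[k+1]≡[n+1]C[k+1] n m)) ⟩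
      (suc n C suc m) * E ∎
    where
    E = signedEulerian (suc m) k j

corollary5p3 : (n k j : ℕ) → j ≤ n → k ≤ n → + (B n k j) ≡ rhs n k j
corollary5p3 n k j _ _ = begin
    + B n k j
  ≡⟨ cong +_ (B≡countWords n k j) ⟩
    + countWords n n k j
  ≡⟨ cong +_ (countWords≡C*signedEulerian n n k j) ⟩
    + ((n C n) * signedEulerian n k j)
  ≡⟨ cong (λ c → + (c * signedEulerian n k j)) (nCn≡1 n) ⟩
    + (1 * signedEulerian n k j)
  ≡⟨ cong +_ (*-identityˡ (signedEulerian n k j)) ⟩
    + signedEulerian n k j
  ≡⟨ signedEulerian≡rhs n k j ⟩
    rhs n k j ∎
  where
  open Data.Nat using (_*_)
  open import Data.Nat.Properties using (*-identityˡ)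
  open import Data.Nat.Combinatorics using (_C_; nCn≡1)
  open import Relation.Binary.PropositionalEquality using (cong)
  open Relation.Binary.PropositionalEquality.≡-Reasoning
  open WindowCount using (countWords; B≡countWords)
  open CountWordsFormula using (countWords≡C*signedEulerian)
  open InsertionRecurrence using (signedEulerian; signedEulerian≡rhs)
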